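{- Fix an integer $r>1$ and let $f_r$ be the Newman–Conway sequence: $f_r(i)=1$ for $1\le i\le r+1$ and $f_r(n)=f_r(n-f_r(n-1))+f_r(f_r(n-1))$ for $n> r+1$. Define $M_1(n)=1$ for $1\le n\le r+1$ and $M_1(n)=M_1(n-f_r(n-1))+1$ for $n>r+1$, and let $\alpha_1(g)=\min\{n : M_1(n)=g\}$. Let $E_i=1$ for $1\le i\le r$ and $E_n=E_{n-1}+E_{n-r}$ for $n>r$. Then for every $g>1$, $\alpha_1(g)=E_{2r+g-2}+1$.
   Context: $M_1$ is the maternal generation sequence of $f_r$, i.e. the generation sequence based on the spot function $S_1(n)=n-f_r(n-1)$, with the same number $r+1$ of initial conditions as $f_r$; $\alpha_1(g)$ is the start of the $g$-th maternal generation. -}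

module Defs where

open import Data.Nat using (ℕ; zero; suc; _+_; _∸_; _≤_; _≤?_)
open import Data.Product using (_×_)
open import Relation.Nullary using (yes; no)

-- All sequences are indexed from 1 (index 0 is a junk value).
-- Recursions are by fuel; with fuel ≥ the index every call in the recursion
-- tree has enough fuel (all arguments decrease strictly, since 1 ≤ f(n-1) ≤ n-1),
-- so these compute the paper's sequences exactly.

nc-fuel : ℕ → ℕ → ℕ → ℕ
nc-fuel r zero    n = 0
nc-fuel r (suc k) n with n ≤? suc r
... | yes _ = 1
... | no  _ = nc-fuel r k (n ∸ nc-fuel r k (n ∸ 1)) + nc-fuel r k (nc-fuel r k (n ∸ 1))

f : ℕ → ℕ → ℕ
f r n = nc-fuel r n n

M₁-fuel : ℕ → ℕ → ℕ → ℕ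
M₁-fuel r zero    n = 0
M₁-fuel r (suc k) n with n ≤? suc r
... | yes _ = 1
... | no  _ = M₁-fuel r k (n ∸ f r (n ∸ 1)) + 1

M₁ : ℕ → ℕ → ℕ
M₁ r n = M₁-fuel r n n

E-fuel : ℕ → ℕ → ℕ → ℕ
E-fuel r zero    n = 0
E-fuel r (suc k) n with n ≤? r
... | yes _ = 1
... | no  _ = E-fuel r k (n ∸ 1) + E-fuel r k (n ∸ r)

E : ℕ → ℕ → ℕ
E r n = E-fuel r n n

IsAlpha₁ : ℕ → ℕ → ℕ → Set
IsAlpha₁ r g a = (1 ≤ a × M₁ r a ≡ g) × (∀ n → 1 ≤ n → M₁ r n ≡ g → a ≤ n)
  where open import Relation.Binary.PropositionalEquality using (_≡_)

module Submission where

-- Write A_t = E_{t+2r} (so A_0 = r + 1).  The theorem says that the maternal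
-- generation M₁ first reaches the value t + 2 at A_t + 1.  We prove the sharper
-- fact that the generations are exactly the blocks  (A_t, A_{t+1}]:
--   M₁(n) = t + 2  whenever  A_t < n ≤ A_{t+1}.
-- The argument follows the self-similar structure of f:
--   1. the fuelled definitions compute the recurrences (for f this goes together
--      with the bounds 1 ≤ f(n) < n, which keep all recursive calls in range);
--   2. f is slow (f(n+1) - f(n) ∈ {0,1}), hence monotone and 1-Lipschitz;
--   3. a "window" lemma: if f(A) = c, f(A+1) = c+1 and X = c + d with
--      f(X-1) = f(X) = d, then f(A+X-1) = f(A+X) = X and f(A+X+1) = X+1;
--   4. iterating the window along E_{n+1} = E_n + E_{n+1-r} gives
--      f(E_{i+r} - 1) = f(E_{i+r}) = E_i and f(A_t + 1) = E_{t+r} + 1;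
--   5. these values place the parent n - f(n-1) of every n in (A_t, A_{t+1}]
--      inside (A_{t-1}, A_t], so M₁ is constant on the block by induction on t.
-- The theorem follows since every n ≤ A_t has generation at most t + 1.
-- The development only needs r ≥ 1, which the hypothesis r > 1 provides.

open import Defs
open import Data.Nat
open import Data.Nat.Properties
open import Data.Nat.Induction using (<-rec)
open import Data.Product using (_×_; _,_; proj₁; proj₂)
open import Data.Sum using (_⊎_; inj₁; inj₂)
import Data.Sum as Sum
open import Data.Empty using (⊥-elim)
open import Relation.Nullary using (Dec; yes; no)
open import Relation.Binary.Definitions using (tri<; tri≈; tri>)
open import Relation.Binary.PropositionalEquality

nc-fuel-base : ∀ r k n → n ≤ suc r → nc-fuel r (suc k) n ≡ 1
nc-fuel-base r k n n≤ with n ≤? suc r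
... | yes _ = refl
... | no n≰ = ⊥-elim (n≰ n≤)

nc-fuel-step : ∀ r k n → suc r < n →
  nc-fuel r (suc k) n ≡ nc-fuel r k (n ∸ nc-fuel r k (n ∸ 1)) + nc-fuel r k (nc-fuel r k (n ∸ 1))
nc-fuel-step r k n r<n with n ≤? suc r
... | yes n≤ = ⊥-elim (<⇒≱ r<n n≤)
... | no _ = refl

M₁-fuel-base : ∀ r k n → n ≤ suc r → M₁-fuel r (suc k) n ≡ 1
M₁-fuel-base r k n n≤ with n ≤? suc r
... | yes _ = refl
... | no n≰ = ⊥-elim (n≰ n≤)

M₁-fuel-step : ∀ r k n → suc r < n → M₁-fuel r (suc k) n ≡ M₁-fuel r k (n ∸ f r (n ∸ 1)) + 1
M₁-fuel-step r k n r<n with n ≤? suc r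
... | yes n≤ = ⊥-elim (<⇒≱ r<n n≤)
... | no _ = refl

E-fuel-base : ∀ r k n → n ≤ r → E-fuel r (suc k) n ≡ 1
E-fuel-base r k n n≤ with n ≤? r
... | yes _ = refl
... | no n≰ = ⊥-elim (n≰ n≤)

E-fuel-step : ∀ r k n → r < n → E-fuel r (suc k) n ≡ E-fuel r k (n ∸ 1) + E-fuel r k (n ∸ r)
E-fuel-step r k n r<n with n ≤? r
... | yes n≤ = ⊥-elim (<⇒≱ r<n n≤)
... | no _ = refl

Settled : (ℕ → ℕ → ℕ) → ℕ → Set
Settled g n = ∀ k → n ≤ k → g k n ≡ g n n

settle : ∀ g m v → (∀ k → m ≤ k → g (suc k) (suc m) ≡ v) → Settled g (suc m)
settle g m v h (suc k) (s≤s m≤k) = trans (h k m≤k) (sym (h m ≤-refl))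

parent-bounds : ∀ {m c} → 1 ≤ c → c < m → 2 ≤ suc m ∸ c × suc m ∸ c ≤ m
parent-bounds {m} {c} 1≤c c<m = m+n≤o⇒m≤o∸n 2 (s≤s c<m) , ∸-monoʳ-≤ (suc m) 1≤c

module _ (r : ℕ) (r≥1 : 1 ≤ r) where

  private
    2≤r+1 : 2 ≤ suc r
    2≤r+1 = s≤s r≥1

  nc-unfold : ∀ {m} k → suc r ≤ m → m ≤ k →
    Settled (nc-fuel r) m → Settled (nc-fuel r) (suc m ∸ f r m) → Settled (nc-fuel r) (f r m) →
    suc m ∸ f r m ≤ m → f r m ≤ m →
    nc-fuel r (suc k) (suc m) ≡ f r (suc m ∸ f r m) + f r (f r m)
  nc-unfold {m} k r<m m≤k settled-m settled-d settled-c d≤m c≤m = begin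
      nc-fuel r (suc k) (suc m)
    ≡⟨ nc-fuel-step r k (suc m) (s≤s r<m) ⟩
      nc-fuel r k (suc m ∸ nc-fuel r k m) + nc-fuel r k (nc-fuel r k m)
    ≡⟨ cong (λ c → nc-fuel r k (suc m ∸ c) + nc-fuel r k c) (settled-m k m≤k) ⟩
      nc-fuel r k (suc m ∸ f r m) + nc-fuel r k (f r m)
    ≡⟨ cong₂ _+_ (settled-d k (≤-trans d≤m m≤k)) (settled-c k (≤-trans c≤m m≤k)) ⟩
      f r (suc m ∸ f r m) + f r (f r m) ∎
    where open ≡-Reasoning

  -- The facts about f at n ≥ 1 that are proved simultaneously by strong induction:
  -- settledness needs the bounds at smaller arguments and conversely.
  record Sound (n : ℕ) : Set where
    field
      settled  : Settled (nc-fuel r) n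
      positive : 1 ≤ f r n
      bounded  : f r n ≤ n
      smaller  : 2 ≤ n → f r n < n

  sound : ∀ n → 1 ≤ n → Sound n
  sound = <-rec (λ n → 1 ≤ n → Sound n) step
    where
    step : ∀ n → (∀ {j} → j < n → 1 ≤ j → Sound j) → 1 ≤ n → Sound n
    step (suc m) ih _ = by-cases (suc m ≤? suc r)
      where
      by-cases : Dec (suc m ≤ suc r) → Sound (suc m)
      by-cases (yes n≤r+1) = record
        { settled  = settle (nc-fuel r) m 1 value
        ; positive = ≤-reflexive (sym f≡1)
        ; bounded  = subst (_≤ suc m) (sym f≡1) (s≤s z≤n)
        ; smaller  = subst (_< suc m) (sym f≡1)
        }
        where
        value : ∀ k → m ≤ k → nc-fuel r (suc k) (suc m) ≡ 1
        value k _ = nc-fuel-base r k (suc m) n≤r+1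
        f≡1 : f r (suc m) ≡ 1
        f≡1 = value m ≤-refl
      by-cases (no n≰r+1) = record
        { settled  = settle (nc-fuel r) m _ value
        ; positive = subst (1 ≤_) (sym f≡) (≤-trans c.positive (m≤n+m _ _))
        ; bounded  = <⇒≤ f<
        ; smaller  = λ _ → f<
        }
        where
        r<m : suc r ≤ m
        r<m = ≤-pred (≰⇒> n≰r+1)
        2≤m : 2 ≤ m
        2≤m = ≤-trans 2≤r+1 r<m
        module m = Sound (ih ≤-refl (≤-trans (s≤s z≤n) 2≤m))
        c : ℕ
        c = f r m
        c<m : c < m
        c<m = m.smaller 2≤m
        d : ℕ
        d = suc m ∸ c
        d-bounds : 2 ≤ d × d ≤ m
        d-bounds = parent-bounds m.positive c<m
        module d = Sound (ih (s≤s (proj₂ d-bounds)) (≤-trans (s≤s z≤n) (proj₁ d-bounds)))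
        module c = Sound (ih (≤-trans c<m (n≤1+n m)) m.positive)
        value : ∀ k → m ≤ k → nc-fuel r (suc k) (suc m) ≡ f r d + f r c
        value k m≤k = nc-unfold k r<m m≤k m.settled d.settled c.settled (proj₂ d-bounds) (<⇒≤ c<m)
        f≡ : f r (suc m) ≡ f r d + f r c
        f≡ = value m ≤-refl
        -- f(d) < d and f(c) ≤ c, while d + c = m + 1.
        f< : f r (suc m) < suc m
        f< = subst₂ _<_ (sym f≡) (m∸n+n≡m (≤-trans (<⇒≤ c<m) (n≤1+n m)))
                    (+-mono-≤ (d.smaller (proj₁ d-bounds)) c.bounded)

  f-positive : ∀ {n} → 1 ≤ n → 1 ≤ f r n
  f-positive {n} 1≤n = Sound.positive (sound n 1≤n)

  f-bounded : ∀ {n} → 1 ≤ n → f r n ≤ n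
  f-bounded {n} 1≤n = Sound.bounded (sound n 1≤n)

  f-smaller : ∀ {n} → 2 ≤ n → f r n < n
  f-smaller {n} 2≤n = Sound.smaller (sound n (≤-trans (s≤s z≤n) 2≤n)) 2≤n

  f-initial : ∀ {n} → 1 ≤ n → n ≤ suc r → f r n ≡ 1
  f-initial {suc m} _ n≤r+1 = nc-fuel-base r m (suc m) n≤r+1

  parent-range : ∀ {m} → suc r ≤ m → 2 ≤ suc m ∸ f r m × suc m ∸ f r m ≤ m
  parent-range {m} r<m = parent-bounds (f-positive (≤-trans (s≤s z≤n) 2≤m)) (f-smaller 2≤m)
    where
    2≤m : 2 ≤ m
    2≤m = ≤-trans 2≤r+1 r<m

  f-rec : ∀ {m} → suc r ≤ m → f r (suc m) ≡ f r (suc m ∸ f r m) + f r (f r m)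
  f-rec {m} r<m = nc-unfold m r<m ≤-refl (settled m 1≤m) (settled _ (≤-trans (s≤s z≤n) (proj₁ (parent-range r<m))))
                    (settled _ (f-positive 1≤m)) (proj₂ (parent-range r<m)) (f-bounded 1≤m)
    where
    settled : ∀ n → 1 ≤ n → Settled (nc-fuel r) n
    settled n 1≤n = Sound.settled (sound n 1≤n)
    1≤m : 1 ≤ m
    1≤m = ≤-trans (s≤s z≤n) (≤-trans 2≤r+1 r<m)

  f-first-rise : f r (suc (suc r)) ≡ 2
  f-first-rise = begin
      f r (suc (suc r))
    ≡⟨ f-rec ≤-refl ⟩
      f r (suc (suc r) ∸ f r (suc r)) + f r (f r (suc r))
    ≡⟨ cong (λ c → f r (suc (suc r) ∸ c) + f r c) f[r+1]≡1 ⟩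
      f r (suc r) + f r 1
    ≡⟨ cong₂ _+_ f[r+1]≡1 (f-initial ≤-refl (s≤s z≤n)) ⟩
      2 ∎
    where
    open ≡-Reasoning
    f[r+1]≡1 : f r (suc r) ≡ 1
    f[r+1]≡1 = f-initial (s≤s z≤n) ≤-refl

  Step : ℕ → ℕ → Set
  Step x y = y ≡ x ⊎ y ≡ suc x

  step-upper : ∀ {x y} → Step x y → y ≤ suc x
  step-upper (inj₁ y≡x)   = ≤-trans (≤-reflexive y≡x) (n≤1+n _)
  step-upper (inj₂ y≡1+x) = ≤-reflexive y≡1+x

  step-+ʳ : ∀ {x y} b → Step x y → Step (x + b) (y + b)
  step-+ʳ b = Sum.map (cong (_+ b)) (cong (_+ b))

  step-+ˡ : ∀ {x y} a → Step x y → Step (a + x) (a + y)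
  step-+ˡ a = Sum.map (cong (a +_)) (λ y≡1+x → trans (cong (a +_) y≡1+x) (+-suc a _))

  -- f is slow: consecutive values differ by 0 or 1.  Beyond the initial range
  -- f(n+1) is a sum of two f-values at which f takes a slow step (depending on
  -- whether f(n) = f(n-1) or f(n) = f(n-1) + 1), and one of the summands is fixed.
  f-step : ∀ n → Step (f r n) (f r (suc n))
  f-step = <-rec (λ n → Step (f r n) (f r (suc n))) step
    where
    step : ∀ n → (∀ {j} → j < n → Step (f r j) (f r (suc j))) → Step (f r n) (f r (suc n))
    step n ih with <-cmp n (suc r)
    step zero    ih | tri< _ _ _ = inj₂ (f-initial ≤-refl (s≤s z≤n))
    step (suc m) ih | tri< n<r+1 _ _ =
      inj₁ (trans (f-initial (s≤s z≤n) n<r+1) (sym (f-initial (s≤s z≤n) (<⇒≤ n<r+1))))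
    step n       ih | tri≈ _ refl _ =
      inj₂ (trans f-first-rise (cong suc (sym (f-initial (s≤s z≤n) ≤-refl))))
    step (suc m) ih | tri> _ _ r+1<n = slow (ih ≤-refl)
      where
      r<m : suc r ≤ m
      r<m = ≤-pred r+1<n
      c : ℕ
      c = f r m
      c≤m : c ≤ m
      c≤m = f-bounded (≤-trans (s≤s z≤n) r<m)
      j : ℕ
      j = suc m ∸ c
      f[n]≡ : f r (suc m) ≡ f r j + f r c
      f[n]≡ = f-rec r<m
      f[n+1]≡ : f r (suc (suc m)) ≡ f r (suc (suc m) ∸ f r (suc m)) + f r (f r (suc m))
      f[n+1]≡ = f-rec (≤-trans r<m (n≤1+n m))
      slow : Step c (f r (suc m)) → Step (f r (suc m)) (f r (suc (suc m)))
      slow (inj₁ flat) = subst₂ Step (sym f[n]≡) (sym f[n+1]≡′) (step-+ʳ (f r c) (ih j<n))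
        where
        j<n : j < suc m
        j<n = s≤s (proj₂ (parent-range r<m))
        f[n+1]≡′ : f r (suc (suc m)) ≡ f r (suc j) + f r c
        f[n+1]≡′ = trans f[n+1]≡ (trans (cong (λ x → f r (suc (suc m) ∸ x) + f r x) flat)
                                        (cong (λ i → f r i + f r c) (+-∸-assoc 1 (≤-trans c≤m (n≤1+n m)))))
      slow (inj₂ rise) = subst₂ Step (sym f[n]≡) (sym f[n+1]≡′) (step-+ˡ (f r j) (ih (s≤s c≤m)))
        where
        f[n+1]≡′ : f r (suc (suc m)) ≡ f r j + f r (suc c)
        f[n+1]≡′ = trans f[n+1]≡ (cong (λ x → f r (suc (suc m) ∸ x) + f r x) rise)

  f-monotone : ∀ {a b} → a ≤ b → f r a ≤ f r b
  f-monotone {a} {b} a≤b = subst (λ i → f r a ≤ f r i) (m∸n+n≡m a≤b) (grows (b ∸ a))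
    where
    grows : ∀ k → f r a ≤ f r (k + a)
    grows zero = ≤-refl
    grows (suc k) with f-step (k + a)
    ... | inj₁ flat = ≤-trans (grows k) (≤-reflexive (sym flat))
    ... | inj₂ rise = ≤-trans (grows k) (≤-trans (n≤1+n _) (≤-reflexive (sym rise)))

  f-lipschitz : ∀ a b → f r (a + b) ≤ f r a + b
  f-lipschitz a zero = ≤-reflexive (trans (cong (f r) (+-identityʳ a)) (sym (+-identityʳ _)))
  f-lipschitz a (suc b) = subst₂ _≤_ (cong (f r) (sym (+-suc a b))) (sym (+-suc (f r a) b)) (at-most-one-more (f-step (a + b)))
    where
    at-most-one-more : Step (f r (a + b)) (f r (suc (a + b))) → f r (suc (a + b)) ≤ suc (f r a + b)
    at-most-one-more (inj₁ flat) = ≤-trans (≤-reflexive flat) (≤-trans (f-lipschitz a b) (n≤1+n _))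
    at-most-one-more (inj₂ rise) = ≤-trans (≤-reflexive rise) (s≤s (f-lipschitz a b))

  module Window (A c X d : ℕ) (r<A : suc r ≤ A)
                (f[A] : f r A ≡ c) (f[A+1] : f r (suc A) ≡ suc c)
                (f[X-1] : f r (X ∸ 1) ≡ d) (f[X] : f r X ≡ d)
                (X≡c+d : X ≡ c + d) (1≤X : 1 ≤ X) where

    rec-at-diagonal : ∀ s → f r (A + s) ≡ s → f r (suc (A + s)) ≡ suc c + f r s
    rec-at-diagonal s on-diagonal = begin
        f r (suc (A + s))
      ≡⟨ f-rec (≤-trans r<A (m≤m+n A s)) ⟩
        f r (suc (A + s) ∸ f r (A + s)) + f r (f r (A + s))
      ≡⟨ cong (λ x → f r (suc (A + s) ∸ x) + f r x) on-diagonal ⟩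
        f r (suc A + s ∸ s) + f r s
      ≡⟨ cong (λ i → f r i + f r s) (m+n∸n≡m (suc A) s) ⟩
        f r (suc A) + f r s
      ≡⟨ cong (_+ f r s) f[A+1] ⟩
        suc c + f r s ∎
      where open ≡-Reasoning

    -- Once f(A+s) = X (with s < X), the recurrence keeps the next value ≤ f(A) + f(X) = X.
    capped-at-top : ∀ s → suc s ≤ X → f r (A + s) ≡ X → f r (suc (A + s)) ≤ X
    capped-at-top s s<X at-top = begin
        f r (suc (A + s))
      ≡⟨ f-rec (≤-trans r<A (m≤m+n A s)) ⟩
        f r (suc (A + s) ∸ f r (A + s)) + f r (f r (A + s))
      ≡⟨ cong (λ x → f r (suc (A + s) ∸ x) + f r x) at-top ⟩
        f r (suc (A + s) ∸ X) + f r X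
      ≤⟨ +-mono-≤ (f-monotone back-in-range) (≤-reflexive f[X]) ⟩
        f r A + d
      ≡⟨ trans (cong (_+ d) f[A]) (sym X≡c+d) ⟩
        X ∎
      where
      open ≤-Reasoning
      back-in-range : suc (A + s) ∸ X ≤ A
      back-in-range = subst (suc (A + s) ∸ X ≤_) (m+n∸n≡m A X)
        (∸-monoˡ-≤ X (subst (_≤ A + X) (+-suc A s) (+-monoʳ-≤ A s<X)))

    -- On the diagonal f(A+s) = s (with s < X), the next value exceeds s: writing
    -- X = s + 1 + e, Lipschitz gives d = f(s + e) ≤ f(s) + e, so s + 1 ≤ c + f(s).
    leaves-diagonal : ∀ s → suc s ≤ X → f r (A + s) ≡ s → suc s ≤ f r (suc (A + s))
    leaves-diagonal s s<X on-diagonal =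
      ≤-trans (+-cancelʳ-≤ e (suc s) (c + f r s) X≤) (≤-trans (n≤1+n _) (≤-reflexive (sym (rec-at-diagonal s on-diagonal))))
      where
      open ≤-Reasoning
      e : ℕ
      e = X ∸ suc s
      X≡ : suc s + e ≡ X
      X≡ = m+[n∸m]≡n s<X
      X≤ : suc s + e ≤ c + f r s + e
      X≤ = begin
          suc s + e          ≡⟨ trans X≡ X≡c+d ⟩
          c + d              ≡⟨ cong (c +_) (trans (sym f[X-1]) (cong (λ i → f r (i ∸ 1)) (sym X≡))) ⟩
          c + f r (s + e)    ≤⟨ +-monoʳ-≤ c (f-lipschitz s e) ⟩
          c + (f r s + e)    ≡⟨ sym (+-assoc c (f r s) e) ⟩
          c + f r s + e      ∎

    climb : ∀ s → s ≤ X → s ≤ f r (A + s) × f r (A + s) ≤ X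
    climb zero _ = z≤n , subst (_≤ X) (sym (trans (cong (f r) (+-identityʳ A)) f[A]))
                                      (subst (c ≤_) (sym X≡c+d) (m≤m+n c d))
    climb (suc s) s<X = subst (λ i → suc s ≤ f r i × f r i ≤ X) (sym (+-suc A s)) (next (climb s (<⇒≤ s<X)))
      where
      next : s ≤ f r (A + s) × f r (A + s) ≤ X → suc s ≤ f r (suc (A + s)) × f r (suc (A + s)) ≤ X
      next (lo , hi) with m≤n⇒m<n∨m≡n hi | m≤n⇒m<n∨m≡n lo
      ... | inj₂ at-top | _ =
        ≤-trans s<X (subst (_≤ f r (suc (A + s))) at-top (f-monotone (n≤1+n (A + s)))) , capped-at-top s s<X at-top
      ... | inj₁ below-top | inj₁ above-diagonal =
        ≤-trans above-diagonal (f-monotone (n≤1+n (A + s))) , ≤-trans (step-upper (f-step (A + s))) below-top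
      ... | inj₁ below-top | inj₂ on-diagonal =
        leaves-diagonal s s<X (sym on-diagonal) , ≤-trans (step-upper (f-step (A + s))) below-top

    end : f r (A + X) ≡ X
    end = ≤-antisym (proj₂ (climb X ≤-refl)) (proj₁ (climb X ≤-refl))

    -- f(A+X-1) = X: otherwise f(A+X-1) = X-1 is on the diagonal and
    -- f(A+X) = f(A+1) + f(X-1) = c + 1 + d = X + 1.
    end-1 : f r (A + X ∸ 1) ≡ X
    end-1 = trans (cong (f r) (+-∸-assoc A 1≤X)) (reaches-top (climb (X ∸ 1) (m∸n≤m X 1)))
      where
      1+[X-1]≡X : suc (X ∸ 1) ≡ X
      1+[X-1]≡X = m+[n∸m]≡n 1≤X
      reaches-top : X ∸ 1 ≤ f r (A + (X ∸ 1)) × f r (A + (X ∸ 1)) ≤ X → f r (A + (X ∸ 1)) ≡ X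
      reaches-top (lo , hi) with m≤n⇒m<n∨m≡n hi
      ... | inj₂ at-top = at-top
      ... | inj₁ below-top = ⊥-elim (1+n≢n (trans (sym overshoot) end))
        where
        open ≡-Reasoning
        on-diagonal : f r (A + (X ∸ 1)) ≡ X ∸ 1
        on-diagonal = ≤-antisym (≤-pred (subst (f r (A + (X ∸ 1)) <_) (sym 1+[X-1]≡X) below-top)) lo
        overshoot : f r (A + X) ≡ suc X
        overshoot = begin
            f r (A + X)                    ≡⟨ cong (f r) (trans (cong (A +_) (sym 1+[X-1]≡X)) (+-suc A _)) ⟩
            f r (suc (A + (X ∸ 1)))        ≡⟨ rec-at-diagonal (X ∸ 1) on-diagonal ⟩
            suc c + f r (X ∸ 1)            ≡⟨ cong (λ y → suc (c + y)) f[X-1] ⟩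
            suc (c + d)                    ≡⟨ cong suc (sym X≡c+d) ⟩
            suc X                          ∎

    end+1 : f r (suc (A + X)) ≡ suc X
    end+1 = trans (rec-at-diagonal X end) (cong suc (trans (cong (c +_) f[X]) (sym X≡c+d)))

  E-unfold : ∀ {m} k → r ≤ m → m ≤ k → Settled (E-fuel r) m → Settled (E-fuel r) (suc m ∸ r) →
    E-fuel r (suc k) (suc m) ≡ E r m + E r (suc m ∸ r)
  E-unfold {m} k r≤m m≤k settled-m settled-j =
    trans (E-fuel-step r k (suc m) (s≤s r≤m))
          (cong₂ _+_ (settled-m k m≤k) (settled-j k (≤-trans (∸-monoʳ-≤ (suc m) r≥1) m≤k)))

  E-settled : ∀ n → 1 ≤ n → Settled (E-fuel r) n
  E-settled = <-rec (λ n → 1 ≤ n → Settled (E-fuel r) n) step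
    where
    step : ∀ n → (∀ {j} → j < n → 1 ≤ j → Settled (E-fuel r) j) → 1 ≤ n → Settled (E-fuel r) n
    step (suc m) ih _ = by-cases (suc m ≤? r)
      where
      by-cases : Dec (suc m ≤ r) → Settled (E-fuel r) (suc m)
      by-cases (yes n≤r) = settle (E-fuel r) m 1 (λ k _ → E-fuel-base r k (suc m) n≤r)
      by-cases (no n≰r) = settle (E-fuel r) m _ (λ k m≤k → E-unfold k r≤m m≤k (ih ≤-refl (≤-trans r≥1 r≤m)) (ih j<n 1≤j))
        where
        r≤m : r ≤ m
        r≤m = ≤-pred (≰⇒> n≰r)
        1≤j : 1 ≤ suc m ∸ r
        1≤j = m<n⇒0<n∸m (s≤s r≤m)
        j<n : suc m ∸ r < suc m
        j<n = s≤s (∸-monoʳ-≤ (suc m) r≥1)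

  E-rec : ∀ {m} → r ≤ m → E r (suc m) ≡ E r m + E r (suc m ∸ r)
  E-rec {m} r≤m = E-unfold m r≤m ≤-refl (E-settled m (≤-trans r≥1 r≤m)) (E-settled _ (m<n⇒0<n∸m (s≤s r≤m)))

  E-add : ∀ j → E r (suc (j + r)) ≡ E r (j + r) + E r (suc j)
  E-add j = trans (E-rec (m≤n+m r j)) (cong (λ i → E r (j + r) + E r i) (m+n∸n≡m (suc j) r))

  E-initial : ∀ {n} → 1 ≤ n → n ≤ r → E r n ≡ 1
  E-initial {suc m} _ n≤r = E-fuel-base r m (suc m) n≤r

  E-positive : ∀ n → 1 ≤ n → 1 ≤ E r n
  E-positive (suc m) _ = by-cases (suc m ≤? r)
    where
    by-cases : Dec (suc m ≤ r) → 1 ≤ E r (suc m)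
    by-cases (yes n≤r) = ≤-reflexive (sym (E-initial (s≤s z≤n) n≤r))
    by-cases (no n≰r) = subst (1 ≤_) (sym (E-rec r≤m)) (≤-trans (E-positive m (≤-trans r≥1 r≤m)) (m≤m+n _ _))
      where
      r≤m : r ≤ m
      r≤m = ≤-pred (≰⇒> n≰r)

  E-ramp : ∀ i → i ≤ r → E r (i + r) ≡ suc i
  E-ramp zero    _   = E-initial r≥1 ≤-refl
  E-ramp (suc i) i<r = trans (E-add i) (trans (cong₂ _+_ (E-ramp i (<⇒≤ i<r)) (E-initial (s≤s z≤n) i<r))
                                                (+-comm (suc i) 1))

  -- The anchors A_t = E_{t+2r}; A_t is the last member of generation t + 1.
  anchor : ℕ → ℕ
  anchor t = E r (t + r + r)

  anchor-initial : anchor 0 ≡ suc r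
  anchor-initial = E-ramp r ≤-refl

  anchor-step : ∀ t → anchor (suc t) ≡ anchor t + E r (suc t + r)
  anchor-step t = E-add (t + r)

  anchor-above-r : ∀ t → suc r ≤ anchor t
  anchor-above-r zero    = ≤-reflexive (sym anchor-initial)
  anchor-above-r (suc t) = ≤-trans (anchor-above-r t) (subst (anchor t ≤_) (sym (anchor-step t)) (m≤m+n _ _))

  Plateau : ℕ → Set
  Plateau i = f r (E r (i + r) ∸ 1) ≡ E r i × f r (E r (i + r)) ≡ E r i

  Rise : ℕ → Set
  Rise t = f r (suc (anchor t)) ≡ suc (E r (t + r))

  -- For 1 ≤ i ≤ r both sides of a plateau are in the initial segments: E_{i+r} = i + 1 ≤ r + 1 and E_i = 1.
  plateau-initial : ∀ i → 1 ≤ i → i ≤ r → Plateau i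
  plateau-initial (suc i) _ i<r =
    trans (cong (λ x → f r (x ∸ 1)) ramp) (trans (f-initial (s≤s z≤n) (m≤n⇒m≤1+n i<r)) (sym E≡1)) ,
    trans (cong (f r) ramp) (trans (f-initial (s≤s z≤n) (s≤s i<r)) (sym E≡1))
    where
    ramp : E r (suc i + r) ≡ suc (suc i)
    ramp = E-ramp (suc i) i<r
    E≡1 : E r (suc i) ≡ 1
    E≡1 = E-initial (s≤s z≤n) i<r

  rise-initial : Rise 0
  rise-initial = trans (cong (λ x → f r (suc x)) anchor-initial)
                       (trans f-first-rise (cong suc (sym (E-initial r≥1 ≤-refl))))

  -- The window lemma
  -- applied at A = A_t, X = E_{t+1+r} = E_{t+r} + E_{t+1} produces the plateau at
  -- index t + 1 + r (since A_{t+1} = A_t + X) and the rise after A_{t+1}.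
  AnchorsUpTo : ℕ → Set
  AnchorsUpTo t = (∀ i → 1 ≤ i → i ≤ t + r → Plateau i) × Rise t

  anchors-up-to : ∀ t → AnchorsUpTo t
  anchors-up-to zero = plateau-initial , rise-initial
  anchors-up-to (suc t) with anchors-up-to t
  ... | plateaus , rise = plateaus′ , rise′
    where
    plateau[t+1] : Plateau (suc t)
    plateau[t+1] = plateaus (suc t) (s≤s z≤n) (subst (_≤ t + r) (+-comm t 1) (+-monoʳ-≤ t r≥1))
    module W = Window (anchor t) (E r (t + r)) (E r (suc t + r)) (E r (suc t)) (anchor-above-r t)
                      (proj₂ (plateaus (t + r) (≤-trans r≥1 (m≤n+m r t)) ≤-refl)) rise
                      (proj₁ plateau[t+1]) (proj₂ plateau[t+1]) (E-add t) (E-positive _ (s≤s z≤n))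
    plateaus′ : ∀ i → 1 ≤ i → i ≤ suc t + r → Plateau i
    plateaus′ i 1≤i i≤ with m≤n⇒m<n∨m≡n i≤
    ... | inj₁ i<  = plateaus i 1≤i (≤-pred i<)
    ... | inj₂ refl = trans (cong (λ x → f r (x ∸ 1)) (anchor-step t)) W.end-1 ,
                      trans (cong (f r) (anchor-step t)) W.end
    rise′ : Rise (suc t)
    rise′ = trans (cong (λ x → f r (suc x)) (anchor-step t)) W.end+1

  plateau : ∀ i → 1 ≤ i → Plateau i
  plateau i 1≤i = proj₁ (anchors-up-to i) i 1≤i (m≤m+n i r)

  -- M₁ is settled at every n ≥ 1, because its parent index lies in [1, n - 1].
  M₁-settled : ∀ n → 1 ≤ n → Settled (M₁-fuel r) n
  M₁-settled = <-rec (λ n → 1 ≤ n → Settled (M₁-fuel r) n) step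
    where
    step : ∀ n → (∀ {j} → j < n → 1 ≤ j → Settled (M₁-fuel r) j) → 1 ≤ n → Settled (M₁-fuel r) n
    step (suc m) ih _ = by-cases (suc m ≤? suc r)
      where
      by-cases : Dec (suc m ≤ suc r) → Settled (M₁-fuel r) (suc m)
      by-cases (yes n≤r+1) = settle (M₁-fuel r) m 1 (λ k _ → M₁-fuel-base r k (suc m) n≤r+1)
      by-cases (no n≰r+1) = settle (M₁-fuel r) m _ value
        where
        r<m : suc r ≤ m
        r<m = ≤-pred (≰⇒> n≰r+1)
        parent : ℕ
        parent = suc m ∸ f r m
        value : ∀ k → m ≤ k → M₁-fuel r (suc k) (suc m) ≡ M₁ r parent + 1
        value k m≤k = trans (M₁-fuel-step r k (suc m) (s≤s r<m))
          (cong (_+ 1) (ih (s≤s (proj₂ (parent-range r<m))) (≤-trans (s≤s z≤n) (proj₁ (parent-range r<m)))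
                           k (≤-trans (proj₂ (parent-range r<m)) m≤k)))

  M₁-initial : ∀ {n} → 1 ≤ n → n ≤ suc r → M₁ r n ≡ 1
  M₁-initial {suc m} _ n≤r+1 = M₁-fuel-base r m (suc m) n≤r+1

  M₁-rec : ∀ {m} → suc r ≤ m → M₁ r (suc m) ≡ suc (M₁ r (suc m ∸ f r m))
  M₁-rec {m} r<m = trans (M₁-fuel-step r m (suc m) (s≤s r<m))
    (trans (cong (_+ 1) (M₁-settled _ (≤-trans (s≤s z≤n) (proj₁ (parent-range r<m))) m (proj₂ (parent-range r<m))))
           (+-comm _ 1))

  -- If f(A + X - 1) = X and m < A + X, then the parent of m + 1 is at most A:
  -- writing A + X - 1 = m + e, Lipschitz gives X ≤ f(m) + e, so m + 1 ≤ A + f(m).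
  parent-at-most : ∀ A X m → f r (A + X ∸ 1) ≡ X → m < A + X → suc m ∸ f r m ≤ A
  parent-at-most A X m f[A+X-1] m<A+X = m≤n+o⇒m∸n≤o (suc m) (f r m)
    (subst (suc m ≤_) (+-comm A (f r m)) (+-cancelʳ-≤ e (suc m) (A + f r m) shifted))
    where
    open ≤-Reasoning
    e : ℕ
    e = A + X ∸ 1 ∸ m
    m+e≡ : m + e ≡ A + X ∸ 1
    m+e≡ = m+[n∸m]≡n (pred-mono-≤ m<A+X)
    shifted : suc m + e ≤ A + f r m + e
    shifted = begin
        suc (m + e)         ≡⟨ cong suc m+e≡ ⟩
        suc (A + X ∸ 1)     ≡⟨ m+[n∸m]≡n (≤-trans (s≤s z≤n) m<A+X) ⟩
        A + X               ≡⟨ cong (A +_) (trans (sym f[A+X-1]) (cong (f r) (sym m+e≡))) ⟩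
        A + f r (m + e)     ≤⟨ +-monoʳ-≤ A (f-lipschitz m e) ⟩
        A + (f r m + e)     ≡⟨ sym (+-assoc A (f r m) e) ⟩
        A + f r m + e       ∎

  -- If f(A' + c) = c and A' + c ≤ m, then the parent of m + 1 exceeds A':
  -- writing m = A' + c + e, Lipschitz gives f(m) ≤ c + e, so A' + f(m) ≤ m.
  parent-above : ∀ A′ c m → f r (A′ + c) ≡ c → A′ + c ≤ m → A′ < suc m ∸ f r m
  parent-above A′ c m f[A′+c] A′+c≤m = m+n≤o⇒m≤o∸n (suc A′) (s≤s (begin
      A′ + f r m               ≡⟨ cong (λ i → A′ + f r i) (sym m≡) ⟩
      A′ + f r (A′ + c + e)    ≤⟨ +-monoʳ-≤ A′ (f-lipschitz (A′ + c) e) ⟩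
      A′ + (f r (A′ + c) + e)  ≡⟨ cong (λ y → A′ + (y + e)) f[A′+c] ⟩
      A′ + (c + e)             ≡⟨ sym (+-assoc A′ c e) ⟩
      A′ + c + e               ≡⟨ m≡ ⟩
      m                        ∎))
    where
    open ≤-Reasoning
    e : ℕ
    e = m ∸ (A′ + c)
    m≡ : A′ + c + e ≡ m
    m≡ = m+[n∸m]≡n A′+c≤m

  plateau-at-anchor : ∀ t → let X = E r (suc t + r) in
    f r (anchor t + X ∸ 1) ≡ X × f r (anchor t + X) ≡ X
  plateau-at-anchor t = subst (λ a → f r (a ∸ 1) ≡ X × f r a ≡ X) (anchor-step t) (plateau (suc t + r) (s≤s z≤n))
    where
    X : ℕ
    X = E r (suc t + r)

  parent-below-anchor : ∀ t m → suc m ≤ anchor (suc t) → suc m ∸ f r m ≤ anchor t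
  parent-below-anchor t m n≤A = parent-at-most (anchor t) _ m (proj₁ (plateau-at-anchor t))
                                               (subst (suc m ≤_) (anchor-step t) n≤A)

  parent-above-anchor : ∀ t m → anchor (suc t) ≤ m → anchor t < suc m ∸ f r m
  parent-above-anchor t m A≤m = parent-above (anchor t) _ m (proj₂ (plateau-at-anchor t))
                                             (subst (_≤ m) (anchor-step t) A≤m)

  -- The generations are the blocks between consecutive anchors:
  -- M₁(n) = t + 2 for A_t < n ≤ A_{t+1}, since the parent of n lies in the previous block
  -- (in the initial segment [1, A_0] = [1, r + 1] when t = 0).
  generation : ∀ t n → anchor t < n → n ≤ anchor (suc t) → M₁ r n ≡ suc (suc t)
  generation zero (suc m) A<n n≤A =
    trans (M₁-rec r<m) (cong suc (M₁-initial (≤-trans (s≤s z≤n) (proj₁ (parent-range r<m)))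
                                             (subst (suc m ∸ f r m ≤_) anchor-initial (parent-below-anchor 0 m n≤A))))
    where
    r<m : suc r ≤ m
    r<m = ≤-trans (anchor-above-r 0) (≤-pred A<n)
  generation (suc t) (suc m) A<n n≤A =
    trans (M₁-rec r<m) (cong suc (generation t _ (parent-above-anchor t m (≤-pred A<n)) (parent-below-anchor (suc t) m n≤A)))
    where
    r<m : suc r ≤ m
    r<m = ≤-trans (anchor-above-r (suc t)) (≤-pred A<n)

  early : ∀ t n → 1 ≤ n → n ≤ anchor t → M₁ r n ≤ suc t
  early zero n 1≤n n≤A = ≤-reflexive (M₁-initial 1≤n (subst (n ≤_) anchor-initial n≤A))
  early (suc t) n 1≤n n≤A with n ≤? anchor t
  ... | yes n≤A′ = m≤n⇒m≤1+n (early t n 1≤n n≤A′)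
  ... | no  n≰A′ = ≤-reflexive (generation t n (≰⇒> n≰A′) n≤A)

  α₁-generation : ∀ t → IsAlpha₁ r (suc (suc t)) (anchor t + 1)
  α₁-generation t = (m≤n+m 1 _ , generation t _ A<A+1 A+1≤A′) , least
    where
    A<A+1 : anchor t < anchor t + 1
    A<A+1 = subst (anchor t <_) (+-comm 1 (anchor t)) ≤-refl
    A+1≤A′ : anchor t + 1 ≤ anchor (suc t)
    A+1≤A′ = subst (anchor t + 1 ≤_) (sym (anchor-step t)) (+-monoʳ-≤ (anchor t) (E-positive _ (s≤s z≤n)))
    least : ∀ n → 1 ≤ n → M₁ r n ≡ suc (suc t) → anchor t + 1 ≤ n
    least n 1≤n M≡ with n ≤? anchor t
    ... | yes n≤A = ⊥-elim (1+n≰n (subst (_≤ suc t) M≡ (early t n 1≤n n≤A)))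
    ... | no  n≰A = subst (_≤ n) (+-comm 1 (anchor t)) (≰⇒> n≰A)

anchor-index : ∀ r t → 2 * r + suc (suc t) ∸ 2 ≡ t + r + r
anchor-index r t = begin
    2 * r + suc (suc t) ∸ 2   ≡⟨ cong (_∸ 2) (+-suc (2 * r) (suc t)) ⟩
    suc (2 * r + suc t) ∸ 2   ≡⟨ cong (_∸ 1) (+-suc (2 * r) t) ⟩
    2 * r + t                 ≡⟨ +-comm (2 * r) t ⟩
    t + (r + (r + 0))         ≡⟨ cong (λ z → t + (r + z)) (+-identityʳ r) ⟩
    t + (r + r)               ≡⟨ sym (+-assoc t r r) ⟩
    t + r + r                 ∎
  where open ≡-Reasoning

mainTheorem5 : ∀ (r g : ℕ) → 1 < r → 1 < g → IsAlpha₁ r g (E r (2 * r + g ∸ 2) + 1)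
mainTheorem5 r (suc (suc t)) 1<r (s≤s (s≤s z≤n)) =
  subst (λ i → IsAlpha₁ r (suc (suc t)) (E r i + 1)) (sym (anchor-index r t)) (α₁-generation r (<⇒≤ 1<r) t)
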